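{- Let $k\ge 1$ be an odd integer, let $b$ be an indeterminate, and let $A$ be the $k\times k$ matrix with entries $A_{ij}=\delta_{ij}-b\cdot[\,i+j>k\,]$ for $1\le i,j\le k$ (where $[\,\cdot\,]$ is $1$ if the condition holds and $0$ otherwise). Then $$\det A=\sum_{i=0}^{k}(-1)^{\lfloor\frac{i+1}{2}\rfloor}\binom{\lfloor\frac{k-i}{2}\rfloor+i}{i}b^i.$$
   Context: $\delta_{ij}$ is the Kronecker delta. Thus row $i$ of $A$ has $1$ on the diagonal when $2i\le k$, $1-b$ on the diagonal when $2i>k$, $-b$ in the off-diagonal positions $j$ with $j>k-i$, and $0$ elsewhere. This matrix is the coefficient matrix of the linear system $GC_k(x,q\mid i)-x(q-1)\sum_{j=k-i+1}^{k}GC_k(x,q\mid j)=xGC_k(x,q)$, $1\le i\le k$, with $b=x(q-1)$. -}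

module Defs where

open import Level using (Level)
open import Algebra.Bundles using (CommutativeRing)
open import Data.Nat as ℕ using (ℕ; zero; suc; _∸_; ⌊_/2⌋; _<?_)
open import Data.Nat.Combinatorics using (_C_)
open import Data.Fin as Fin using (Fin; toℕ; punchIn)
open import Data.Bool using (if_then_else_)
open import Relation.Nullary.Decidable using (⌊_⌋)

-- Everything is stated over an arbitrary commutative ring R; the
-- indeterminate b is an arbitrary element of R (universal property of ℤ[b]).
module Over {c ℓ : Level} (R : CommutativeRing c ℓ) where
  open CommutativeRing R hiding (zero)

  fromℕ : ℕ → Carrier
  fromℕ zero    = 0#
  fromℕ (suc n) = 1# + fromℕ n

  pow : Carrier → ℕ → Carrier
  pow x zero    = 1#
  pow x (suc n) = x * pow x n

  sgn : ℕ → Carrier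
  sgn zero    = 1#
  sgn (suc n) = - sgn n

  ∑ : (n : ℕ) → (Fin n → Carrier) → Carrier
  ∑ zero    f = 0#
  ∑ (suc n) f = f Fin.zero + ∑ n (λ j → f (Fin.suc j))

  ∑≤ : ℕ → (ℕ → Carrier) → Carrier
  ∑≤ zero    f = f zero
  ∑≤ (suc n) f = ∑≤ n f + f (suc n)

  det : (n : ℕ) → (Fin n → Fin n → Carrier) → Carrier
  det zero    M = 1#
  det (suc n) M =
    ∑ (suc n) (λ j → sgn (toℕ j) * (M Fin.zero j *
                  det n (λ r s → M (Fin.suc r) (punchIn j s))))

  -- The k×k matrix A with A_{ij} = δ_{ij} - b·[i + j > k], 1 ≤ i,j ≤ k.
  -- With 0-based indices i' = i - 1, j' = j - 1 the condition i + j > k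
  -- reads k < i' + j' + 2.
  A : (k : ℕ) → Carrier → Fin k → Fin k → Carrier
  A k b i j =
    (if ⌊ i Fin.≟ j ⌋ then 1# else 0#) +
    - (b * (if ⌊ k <? toℕ i ℕ.+ toℕ j ℕ.+ 2 ⌋ then 1# else 0#))

  rhs : ℕ → Carrier → Carrier
  rhs k b = ∑≤ k (λ i → sgn ⌊ suc i /2⌋ *
                   (fromℕ ((⌊ k ∸ i /2⌋ ℕ.+ i) C i) * pow b i))

{-# OPTIONS --safe #-}
module Submission where

-- Subtracting from each row of A except the first the row above it gives the matrix
-- B_k(b) with 1 on the diagonal, -1 just below it and -b on the antidiagonal i + j = k + 1.
-- Expanding det B_{m+2}(b) along the first row leaves two cofactors: the top-left
-- one is B_m(b) bordered by a unit column, the top-right one is the transpose of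
-- -B_{m+1}(-b).  Hence D_k(b) = det B_k(b) satisfies
--   D_{m+2}(b) = D_m(b) - b D_{m+1}(-b),   D_0 = 1,   D_1(b) = 1 - b,
-- and Pascal's rule shows that the right-hand side satisfies the same recurrence:
-- the sign (-1)^⌊(i+1)/2⌋ is exactly what the substitution b ↦ -b requires.

open import Defs
open import Level using (Level)
open import Algebra.Bundles using (CommutativeRing)
open import Data.Nat using (ℕ; _%_)
open import Relation.Binary.PropositionalEquality using (_≡_)

open import Data.Nat as ℕ using (zero; suc; _∸_; ⌊_/2⌋)
import Data.Nat.Properties as ℕₚ
open import Data.Nat.Combinatorics using (_C_; nCn≡1; nCk+nC[k+1]≡[n+1]C[k+1])
import Data.Fin
open import Data.Fin as Fin using (Fin; toℕ; punchIn; inject₁)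
import Data.Fin.Properties as Finₚ
open import Data.Vec.Functional using (transpose; updateAt)
open import Data.Vec.Functional.Properties using (updateAt-updates; updateAt-minimal)
open import Data.Bool using (Bool; true; false; if_then_else_; T)
open import Data.Product using (Σ; _×_; _,_)
open import Data.Empty using (⊥-elim)
open import Function using (_∘_)
open import Relation.Nullary using (yes; no; ¬_)
open import Relation.Nullary.Decidable using (⌊_⌋; toWitness; fromWitness)
open import Relation.Binary.PropositionalEquality as ≡ using (_≢_; cong)
import Algebra.Properties.Ring as RingProperties
import Algebra.Properties.AbelianGroup as AbelianGroupProperties
import Algebra.Properties.Group as GroupProperties
import Algebra.Properties.CommutativeSemigroup as CommSemigroupProperties
import Algebra.Solver.CommutativeMonoid as CommMonoidSolver

inject₁≢suc : ∀ {n} (p : Fin n) → inject₁ p ≢ Fin.suc p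
inject₁≢suc {suc n} (Fin.suc p) = inject₁≢suc p ∘ Finₚ.suc-injective

punchIn-avoiding-adjacent : ∀ {n} (p : Fin (suc n)) (j : Fin (suc (suc n))) →
  j ≢ inject₁ p → j ≢ Fin.suc p →
  Σ (Fin n) λ q → punchIn j (inject₁ q) ≡ inject₁ p × punchIn j (Fin.suc q) ≡ Fin.suc p
punchIn-avoiding-adjacent Fin.zero Fin.zero j≢p _ = ⊥-elim (j≢p ≡.refl)
punchIn-avoiding-adjacent Fin.zero (Fin.suc Fin.zero) _ j≢p+1 = ⊥-elim (j≢p+1 ≡.refl)
punchIn-avoiding-adjacent {suc n} Fin.zero (Fin.suc (Fin.suc j)) _ _ = Fin.zero , ≡.refl , ≡.refl
punchIn-avoiding-adjacent {suc n} (Fin.suc p) Fin.zero _ _ = p , ≡.refl , ≡.refl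
punchIn-avoiding-adjacent {suc n} (Fin.suc p) (Fin.suc j) j≢p j≢p+1
  with q , eq₁ , eq₂ ← punchIn-avoiding-adjacent p j (j≢p ∘ cong Fin.suc) (j≢p+1 ∘ cong Fin.suc)
  = Fin.suc q , cong Fin.suc eq₁ , cong Fin.suc eq₂

punchIn-inject₁ : ∀ {n} (j : Fin (suc n)) (s : Fin n) → punchIn (inject₁ j) (inject₁ s) ≡ inject₁ (punchIn j s)
punchIn-inject₁ Fin.zero    s           = ≡.refl
punchIn-inject₁ (Fin.suc j) Fin.zero    = ≡.refl
punchIn-inject₁ (Fin.suc j) (Fin.suc s) = cong Fin.suc (punchIn-inject₁ j s)

punchIn-inject₁-fromℕ : ∀ {n} (j : Fin (suc n)) → punchIn (inject₁ j) (Fin.fromℕ n) ≡ Fin.fromℕ (suc n)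
punchIn-inject₁-fromℕ         Fin.zero    = ≡.refl
punchIn-inject₁-fromℕ {suc n} (Fin.suc j) = cong Fin.suc (punchIn-inject₁-fromℕ j)

punchIn-fromℕ : ∀ n (s : Fin n) → punchIn (Fin.fromℕ n) s ≡ inject₁ s
punchIn-fromℕ (suc n) Fin.zero    = ≡.refl
punchIn-fromℕ (suc n) (Fin.suc s) = cong Fin.suc (punchIn-fromℕ n s)

suc-∸ : ∀ {n j} → j ℕ.< n → suc n ∸ j ≡ suc (suc (n ∸ suc j))
suc-∸ {suc n} {zero}  _           = ≡.refl
suc-∸ {suc n} {suc j} (ℕ.s≤s j<n) = suc-∸ j<n

module Determinant {c ℓ : Level} (R : CommutativeRing c ℓ) where
  open CommutativeRing R hiding (zero)
  open Over R using (∑; sgn; det)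
  open Data.Fin using (fromℕ)
  open RingProperties ring using (-‿distribˡ-*; -‿distribʳ-*; -1*x≈-x)
  open import Algebra.Properties.Semiring.Sum semiring
    using (sum; sum-cong-≋; ∑-comm; ∑-distrib-+; *-distribˡ-sum; *-distribʳ-sum;
           sum-replicate-zero; sum-init-last)
  open import Relation.Binary.Reasoning.Setoid setoid
  open CommMonoidSolver *-commutativeMonoid using (solve; _⊜_; _⊕_)

  Mat : ℕ → Set c
  Mat n = Fin n → Fin n → Carrier

  minor : ∀ {n} → Fin (suc n) → Fin (suc n) → Mat (suc n) → Mat n
  minor i j M r s = M (punchIn i r) (punchIn j s)

  topLeft : ∀ {n} → Mat (suc n) → Mat n
  topLeft M r s = M (inject₁ r) (inject₁ s)

  row₀-term : ∀ {n} → Mat (suc n) → Fin (suc n) → Carrier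
  row₀-term {n} M j = sgn (toℕ j) * (M Fin.zero j * det n (minor Fin.zero j M))

  col₀-term : ∀ {n} → Mat (suc n) → Fin (suc n) → Carrier
  col₀-term {n} M i = sgn (toℕ i) * (M i Fin.zero * det n (minor i Fin.zero M))

  ∑≡sum : ∀ n (f : Fin n → Carrier) → ∑ n f ≡ sum f
  ∑≡sum zero    f = ≡.refl
  ∑≡sum (suc n) f = cong (f Fin.zero +_) (∑≡sum n (f ∘ Fin.suc))

  -- The summands are explicit: `sum` unfolds on `Fin (suc n)`, so they cannot be inferred.
  sum-cong : ∀ {n} (f g : Fin n → Carrier) → (∀ i → f i ≈ g i) → sum f ≈ sum g
  sum-cong f g = sum-cong-≋

  sum-zero : ∀ {n} (f : Fin n → Carrier) → (∀ i → f i ≈ 0#) → sum f ≈ 0#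
  sum-zero {n} f f≈0 = trans (sum-cong f (λ _ → 0#) f≈0) (sum-replicate-zero n)

  sum-linear : ∀ {n} (f g h : Fin n → Carrier) a →
    (∀ j → f j ≈ g j + a * h j) → sum f ≈ sum g + a * sum h
  sum-linear f g h a f≈ = begin
    sum f                        ≈⟨ sum-cong f (λ j → g j + a * h j) f≈ ⟩
    sum (λ j → g j + a * h j)    ≈⟨ ∑-distrib-+ g (λ j → a * h j) ⟩
    sum g + sum (λ j → a * h j)  ≈⟨ +-congˡ (*-distribˡ-sum a h) ⟨
    sum g + a * sum h            ∎

  sum-adjacent-cancel : ∀ {n} (f : Fin (suc (suc n)) → Carrier) (p : Fin (suc n)) →
    f (inject₁ p) + f (Fin.suc p) ≈ 0# →
    (∀ j → j ≢ inject₁ p → j ≢ Fin.suc p → f j ≈ 0#) → sum f ≈ 0#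
  sum-adjacent-cancel f Fin.zero pair≈0 rest≈0 = begin
    f Fin.zero + (f (Fin.suc Fin.zero) + sum (f ∘ Fin.suc ∘ Fin.suc))
      ≈⟨ +-assoc _ _ _ ⟨
    (f Fin.zero + f (Fin.suc Fin.zero)) + sum (f ∘ Fin.suc ∘ Fin.suc)
      ≈⟨ +-cong pair≈0 (sum-zero (f ∘ Fin.suc ∘ Fin.suc) (λ j → rest≈0 _ (λ ()) (λ ()))) ⟩
    0# + 0#
      ≈⟨ +-identityˡ 0# ⟩
    0# ∎
  sum-adjacent-cancel {suc n} f (Fin.suc p) pair≈0 rest≈0 = begin
    f Fin.zero + sum (f ∘ Fin.suc)
      ≈⟨ +-cong (rest≈0 Fin.zero (λ ()) (λ ()))
                (sum-adjacent-cancel (f ∘ Fin.suc) p pair≈0 (λ j j≢p j≢p+1 →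
                  rest≈0 (Fin.suc j) (j≢p ∘ Finₚ.suc-injective) (j≢p+1 ∘ Finₚ.suc-injective))) ⟩
    0# + 0#
      ≈⟨ +-identityˡ 0# ⟩
    0# ∎

  det-expand-row₀ : ∀ n (M : Mat (suc n)) → det (suc n) M ≈ sum (row₀-term M)
  det-expand-row₀ n M = reflexive (∑≡sum (suc n) (row₀-term M))

  det-cong : ∀ n {M N : Mat n} → (∀ i j → M i j ≈ N i j) → det n M ≈ det n N
  det-cong zero    M≈N = refl
  det-cong (suc n) {M} {N} M≈N = begin
    det (suc n) M      ≈⟨ det-expand-row₀ n M ⟩
    sum (row₀-term M)  ≈⟨ sum-cong (row₀-term M) (row₀-term N) (λ j → *-congˡ (*-cong (M≈N Fin.zero j)
                            (det-cong n (λ r s → M≈N (Fin.suc r) (punchIn j s))))) ⟩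
    sum (row₀-term N)  ≈⟨ det-expand-row₀ n N ⟨
    det (suc n) N      ∎

  det-expand-col₀ : ∀ n (M : Mat (suc n)) → det (suc n) M ≈ sum (col₀-term M)
  det-expand-col₀ zero    M = refl
  det-expand-col₀ (suc n) M = trans (det-expand-row₀ (suc n) M) (+-congˡ (begin
    sum (row₀-term M ∘ Fin.suc)
      ≈⟨ sum-cong (row₀-term M ∘ Fin.suc) _ (λ j →
           *-congˡ (*-congˡ (det-expand-col₀ n (minor Fin.zero (Fin.suc j) M)))) ⟩
    sum (λ j → (- s j) * (a j * sum (λ i → s i * (b i * D i j))))
      ≈⟨ sum-cong _ _ (λ j → pull-in (- s j) (a j) (λ i → s i * (b i * D i j))) ⟩
    sum (λ j → sum (λ i → (- s j) * (a j * (s i * (b i * D i j)))))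
      ≈⟨ ∑-comm (λ j i → (- s j) * (a j * (s i * (b i * D i j)))) ⟩
    sum (λ i → sum (λ j → (- s j) * (a j * (s i * (b i * D i j)))))
      ≈⟨ sum-cong _ _ (λ i → sum-cong _ _ (λ j → reorder (s j) (a j) (s i) (b i) (D i j))) ⟩
    sum (λ i → sum (λ j → (- s i) * (b i * (s j * (a j * D i j)))))
      ≈⟨ sum-cong (col₀-term M ∘ Fin.suc) _ (λ i →
           trans (*-congˡ (*-congˡ (det-expand-row₀ n (minor (Fin.suc i) Fin.zero M))))
                 (pull-in (- s i) (b i) (λ j → s j * (a j * D i j)))) ⟨
    sum (col₀-term M ∘ Fin.suc) ∎))
    where
      s : ∀ {m} → Fin m → Carrier
      s k = sgn (toℕ k)
      a b : Fin (suc n) → Carrier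
      a j = M Fin.zero (Fin.suc j)
      b i = M (Fin.suc i) Fin.zero
      D : Fin (suc n) → Fin (suc n) → Carrier
      D i j = det n (λ r s → M (Fin.suc (punchIn i r)) (Fin.suc (punchIn j s)))
      pull-in : ∀ x y (f : Fin (suc n) → Carrier) → x * (y * sum f) ≈ sum (λ i → x * (y * f i))
      pull-in x y f = trans (*-congˡ (*-distribˡ-sum y f)) (*-distribˡ-sum x (λ i → y * f i))
      reorder : ∀ x y z w d → (- x) * (y * (z * (w * d))) ≈ (- z) * (w * (x * (y * d)))
      reorder x y z w d = begin
        (- x) * (y * (z * (w * d)))  ≈⟨ -‿distribˡ-* x _ ⟨
        - (x * (y * (z * (w * d))))  ≈⟨ -‿cong (solve 5 (λ x y z w d →
                                          (x ⊕ (y ⊕ (z ⊕ (w ⊕ d)))) ⊜ (z ⊕ (w ⊕ (x ⊕ (y ⊕ d))))) refl x y z w d) ⟩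
        - (z * (w * (x * (y * d))))  ≈⟨ -‿distribˡ-* z _ ⟩
        (- z) * (w * (x * (y * d)))  ∎

  det-transpose : ∀ n (M : Mat n) → det n (transpose M) ≈ det n M
  det-transpose zero    M = refl
  det-transpose (suc n) M = begin
    det (suc n) (transpose M)      ≈⟨ det-expand-row₀ n (transpose M) ⟩
    sum (row₀-term (transpose M))  ≈⟨ sum-cong (row₀-term (transpose M)) (col₀-term M)
                                        (λ i → *-congˡ (*-congˡ (det-transpose n (minor i Fin.zero M)))) ⟩
    sum (col₀-term M)              ≈⟨ det-expand-col₀ n M ⟨
    det (suc n) M                  ∎

  det-negate : ∀ n (M : Mat n) → det n (λ i j → - M i j) ≈ sgn n * det n M
  det-negate zero    M = sym (*-identityˡ 1#)
  det-negate (suc n) M = begin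
    det (suc n) (λ i j → - M i j)          ≈⟨ det-expand-row₀ n (λ i j → - M i j) ⟩
    sum (row₀-term (λ i j → - M i j))      ≈⟨ sum-cong _ (λ j → (- sgn n) * row₀-term M j) (λ j →
                                                trans (*-congˡ (*-congˡ (det-negate n (minor Fin.zero j M))))
                                                      (reorder _ _ _ _)) ⟩
    sum (λ j → (- sgn n) * row₀-term M j)  ≈⟨ *-distribˡ-sum (- sgn n) (row₀-term M) ⟨
    (- sgn n) * sum (row₀-term M)          ≈⟨ *-congˡ (det-expand-row₀ n M) ⟨
    (- sgn n) * det (suc n) M              ∎
    where
      reorder : ∀ s x t d → s * ((- x) * (t * d)) ≈ (- t) * (s * (x * d))
      reorder s x t d = begin
        s * ((- x) * (t * d))  ≈⟨ *-congˡ (-‿distribˡ-* x _) ⟨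
        s * - (x * (t * d))    ≈⟨ -‿distribʳ-* s _ ⟨
        - (s * (x * (t * d)))  ≈⟨ -‿cong (solve 4 (λ s x t d → (s ⊕ (x ⊕ (t ⊕ d))) ⊜ (t ⊕ (s ⊕ (x ⊕ d))))
                                    refl s x t d) ⟩
        - (t * (s * (x * d)))  ≈⟨ -‿distribˡ-* t _ ⟩
        (- t) * (s * (x * d))  ∎

  punchIn-adjacent : ∀ {n} (p : Fin (suc n)) (f : Fin (suc (suc n)) → Carrier) →
    f (inject₁ p) ≈ f (Fin.suc p) → ∀ s → f (punchIn (inject₁ p) s) ≈ f (punchIn (Fin.suc p) s)
  punchIn-adjacent         Fin.zero    f fp≈fp+1 Fin.zero    = sym fp≈fp+1
  punchIn-adjacent         Fin.zero    f fp≈fp+1 (Fin.suc s) = refl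
  punchIn-adjacent {suc n} (Fin.suc p) f fp≈fp+1 Fin.zero    = refl
  punchIn-adjacent {suc n} (Fin.suc p) f fp≈fp+1 (Fin.suc s) = punchIn-adjacent p (f ∘ Fin.suc) fp≈fp+1 s

  det-adjacent-columns : ∀ n (M : Mat (suc n)) (p : Fin n) →
    (∀ i → M i (inject₁ p) ≈ M i (Fin.suc p)) → det (suc n) M ≈ 0#
  det-adjacent-columns (suc n) M p cols≈ =
    trans (det-expand-row₀ (suc n) M) (sum-adjacent-cancel (row₀-term M) p pair≈0 rest≈0)
    where
      -- Deleting either of the two equal columns leaves the same minor, with opposite signs.
      pair≈0 : row₀-term M (inject₁ p) + row₀-term M (Fin.suc p) ≈ 0#
      pair≈0 = begin
        sgn (toℕ (inject₁ p)) * x + (- sgn (toℕ p)) * y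
          ≈⟨ +-cong (*-congʳ (reflexive (cong sgn (Finₚ.toℕ-inject₁ p)))) (sym (-‿distribˡ-* _ y)) ⟩
        sgn (toℕ p) * x + - (sgn (toℕ p) * y)
          ≈⟨ +-congʳ (*-congˡ x≈y) ⟩
        sgn (toℕ p) * y + - (sgn (toℕ p) * y)
          ≈⟨ -‿inverseʳ _ ⟩
        0# ∎
        where
          x = M Fin.zero (inject₁ p) * det (suc n) (minor Fin.zero (inject₁ p) M)
          y = M Fin.zero (Fin.suc p) * det (suc n) (minor Fin.zero (Fin.suc p) M)
          x≈y : x ≈ y
          x≈y = *-cong (cols≈ Fin.zero)
            (det-cong (suc n) (λ r → punchIn-adjacent p (M (Fin.suc r)) (cols≈ (Fin.suc r))))
      rest≈0 : ∀ j → j ≢ inject₁ p → j ≢ Fin.suc p → row₀-term M j ≈ 0#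
      rest≈0 j j≢p j≢p+1 with q , eq₁ , eq₂ ← punchIn-avoiding-adjacent p j j≢p j≢p+1 =
        trans (*-congˡ (trans (*-congˡ minor≈0) (zeroʳ _))) (zeroʳ _)
        where
          minor≈0 : det (suc n) (minor Fin.zero j M) ≈ 0#
          minor≈0 = det-adjacent-columns n (minor Fin.zero j M) q (λ r →
            ≡.subst₂ (λ u v → M (Fin.suc r) u ≈ M (Fin.suc r) v) (≡.sym eq₁) (≡.sym eq₂) (cols≈ (Fin.suc r)))

  -- Expansion along the first row makes alternation in columns immediate; rows go through the transpose.
  det-adjacent-rows : ∀ n (M : Mat (suc n)) (p : Fin n) →
    (∀ j → M (inject₁ p) j ≈ M (Fin.suc p) j) → det (suc n) M ≈ 0#
  det-adjacent-rows n M p rows≈ =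
    trans (sym (det-transpose (suc n) M)) (det-adjacent-columns n (transpose M) p rows≈)

  det-linear-terms : ∀ n (X Y Z : Mat (suc n)) a →
    (∀ j → row₀-term X j ≈ row₀-term Y j + a * row₀-term Z j) →
    det (suc n) X ≈ det (suc n) Y + a * det (suc n) Z
  det-linear-terms n X Y Z a terms≈ = begin
    det (suc n) X                              ≈⟨ det-expand-row₀ n X ⟩
    sum (row₀-term X)                          ≈⟨ sum-linear (row₀-term X) (row₀-term Y) (row₀-term Z) a terms≈ ⟩
    sum (row₀-term Y) + a * sum (row₀-term Z)  ≈⟨ +-cong (det-expand-row₀ n Y) (*-congˡ (det-expand-row₀ n Z)) ⟨
    det (suc n) Y + a * det (suc n) Z          ∎

  det-linear-row : ∀ n (X Y Z : Mat n) (q : Fin n) a →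
    (∀ j → X q j ≈ Y q j + a * Z q j) →
    (∀ i → i ≢ q → ∀ j → X i j ≈ Y i j) → (∀ i → i ≢ q → ∀ j → X i j ≈ Z i j) →
    det n X ≈ det n Y + a * det n Z
  det-linear-row (suc n) X Y Z Fin.zero a Xq≈ X≈Y X≈Z = det-linear-terms n X Y Z a λ j →
    let s = sgn (toℕ j); d = det n (minor Fin.zero j X) in begin
    s * (X Fin.zero j * d)
      ≈⟨ *-congˡ (*-congʳ (Xq≈ j)) ⟩
    s * ((Y Fin.zero j + a * Z Fin.zero j) * d)
      ≈⟨ distribute s (Y Fin.zero j) (Z Fin.zero j) d ⟩
    s * (Y Fin.zero j * d) + a * (s * (Z Fin.zero j * d))
      ≈⟨ +-cong (*-congˡ (*-congˡ (det-cong n (λ r → X≈Y (Fin.suc r) (λ ()) ∘ punchIn j))))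
                (*-congˡ (*-congˡ (*-congˡ (det-cong n (λ r → X≈Z (Fin.suc r) (λ ()) ∘ punchIn j))))) ⟩
    row₀-term Y j + a * row₀-term Z j ∎
    where
      distribute : ∀ s y z d → s * ((y + a * z) * d) ≈ s * (y * d) + a * (s * (z * d))
      distribute s y z d = begin
        s * ((y + a * z) * d)            ≈⟨ *-congˡ (distribʳ d y (a * z)) ⟩
        s * (y * d + (a * z) * d)        ≈⟨ distribˡ s _ _ ⟩
        s * (y * d) + s * ((a * z) * d)  ≈⟨ +-congˡ (solve 4 (λ s a z d → (s ⊕ ((a ⊕ z) ⊕ d)) ⊜ (a ⊕ (s ⊕ (z ⊕ d))))
                                              refl s a z d) ⟩
        s * (y * d) + a * (s * (z * d))  ∎
  det-linear-row (suc n) X Y Z (Fin.suc q) a Xq≈ X≈Y X≈Z = det-linear-terms n X Y Z a λ j →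
    let s = sgn (toℕ j); x = X Fin.zero j in begin
    s * (x * det n (minor Fin.zero j X))
      ≈⟨ *-congˡ (*-congˡ (det-linear-row n (minor Fin.zero j X) (minor Fin.zero j Y) (minor Fin.zero j Z) q a
           (Xq≈ ∘ punchIn j)
           (λ r r≢q → X≈Y (Fin.suc r) (r≢q ∘ Finₚ.suc-injective) ∘ punchIn j)
           (λ r r≢q → X≈Z (Fin.suc r) (r≢q ∘ Finₚ.suc-injective) ∘ punchIn j))) ⟩
    s * (x * (det n (minor Fin.zero j Y) + a * det n (minor Fin.zero j Z)))
      ≈⟨ distribute s x (det n (minor Fin.zero j Y)) (det n (minor Fin.zero j Z)) ⟩
    s * (x * det n (minor Fin.zero j Y)) + a * (s * (x * det n (minor Fin.zero j Z)))
      ≈⟨ +-cong (*-congˡ (*-congʳ (X≈Y Fin.zero (λ ()) j)))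
                (*-congˡ (*-congˡ (*-congʳ (X≈Z Fin.zero (λ ()) j)))) ⟩
    row₀-term Y j + a * row₀-term Z j ∎
    where
      distribute : ∀ s x d e → s * (x * (d + a * e)) ≈ s * (x * d) + a * (s * (x * e))
      distribute s x d e = begin
        s * (x * (d + a * e))            ≈⟨ *-congˡ (distribˡ x d (a * e)) ⟩
        s * (x * d + x * (a * e))        ≈⟨ distribˡ s _ _ ⟩
        s * (x * d) + s * (x * (a * e))  ≈⟨ +-congˡ (solve 4 (λ s x a e → (s ⊕ (x ⊕ (a ⊕ e))) ⊜ (a ⊕ (s ⊕ (x ⊕ e))))
                                              refl s x a e) ⟩
        s * (x * d) + a * (s * (x * e))  ∎

  det-subtract-previous-row : ∀ n (X M : Mat (suc (suc n))) (p : Fin (suc n)) →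
    (∀ j → X (Fin.suc p) j ≈ M (Fin.suc p) j - M (inject₁ p) j) →
    (∀ i → i ≢ Fin.suc p → ∀ j → X i j ≈ M i j) →
    det (suc (suc n)) X ≈ det (suc (suc n)) M
  det-subtract-previous-row n X M p Xp≈ X≈M = begin
    det (suc (suc n)) X
      ≈⟨ det-linear-row (suc (suc n)) X M M′ (Fin.suc p) (- 1#) Xp≈′ X≈M X≈M′ ⟩
    det (suc (suc n)) M + (- 1#) * det (suc (suc n)) M′
      ≈⟨ +-congˡ (trans (*-congˡ M′≈0) (zeroʳ _)) ⟩
    det (suc (suc n)) M + 0#
      ≈⟨ +-identityʳ _ ⟩
    det (suc (suc n)) M ∎
    where
      M′ : Mat (suc (suc n))
      M′ = updateAt M (Fin.suc p) (λ _ → M (inject₁ p))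
      M′p≈ : ∀ j → M′ (Fin.suc p) j ≈ M (inject₁ p) j
      M′p≈ j = reflexive (cong (λ row → row j) (updateAt-updates (Fin.suc p) M))
      M′≈M : ∀ i → i ≢ Fin.suc p → ∀ j → M′ i j ≈ M i j
      M′≈M i i≢p j = reflexive (cong (λ row → row j) (updateAt-minimal i (Fin.suc p) M i≢p))
      Xp≈′ : ∀ j → X (Fin.suc p) j ≈ M (Fin.suc p) j + (- 1#) * M′ (Fin.suc p) j
      Xp≈′ j = trans (Xp≈ j) (+-congˡ (trans (-‿cong (sym (M′p≈ j))) (sym (-1*x≈-x _))))
      X≈M′ : ∀ i → i ≢ Fin.suc p → ∀ j → X i j ≈ M′ i j
      X≈M′ i i≢p j = trans (X≈M i i≢p j) (sym (M′≈M i i≢p j))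
      M′≈0 : det (suc (suc n)) M′ ≈ 0#
      M′≈0 = det-adjacent-rows (suc n) M′ p (λ j →
        trans (M′≈M (inject₁ p) (inject₁≢suc p) j) (sym (M′p≈ j)))

  rowDifferences : ∀ {n} → Mat (suc n) → Mat (suc n)
  rowDifferences M Fin.zero    j = M Fin.zero j
  rowDifferences M (Fin.suc i) j = M (Fin.suc i) j - M (inject₁ i) j

  -- Only the rows below row r are differenced; lowering r one step at a time subtracts
  -- a row that has not been modified yet.
  rowDifferencesFrom : ∀ {n} → ℕ → Mat (suc n) → Mat (suc n)
  rowDifferencesFrom r M Fin.zero    j = M Fin.zero j
  rowDifferencesFrom r M (Fin.suc i) j with r ℕ.≤? toℕ i
  ... | yes _ = M (Fin.suc i) j - M (inject₁ i) j
  ... | no  _ = M (Fin.suc i) j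

  rowDifferencesFrom-zero : ∀ {n} (M : Mat (suc n)) i j → rowDifferencesFrom 0 M i j ≈ rowDifferences M i j
  rowDifferencesFrom-zero M Fin.zero    j = refl
  rowDifferencesFrom-zero M (Fin.suc i) j with 0 ℕ.≤? toℕ i
  ... | yes _  = refl
  ... | no 0≰i = ⊥-elim (0≰i ℕ.z≤n)

  rowDifferencesFrom-above : ∀ {n} r (M : Mat (suc n)) i j → toℕ i ℕ.≤ r → rowDifferencesFrom r M i j ≈ M i j
  rowDifferencesFrom-above r M Fin.zero    j _   = refl
  rowDifferencesFrom-above r M (Fin.suc i) j i<r with r ℕ.≤? toℕ i
  ... | yes r≤i = ⊥-elim (ℕₚ.<⇒≱ i<r r≤i)
  ... | no  _   = refl

  det-rowDifferencesFrom-step : ∀ n (M : Mat (suc (suc n))) (p : Fin (suc n)) →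
    det (suc (suc n)) (rowDifferencesFrom (toℕ p) M) ≈ det (suc (suc n)) (rowDifferencesFrom (suc (toℕ p)) M)
  det-rowDifferencesFrom-step n M p = det-subtract-previous-row n X Y p X-at-p X-elsewhere
    where
      X = rowDifferencesFrom (toℕ p) M
      Y = rowDifferencesFrom (suc (toℕ p)) M
      Y-at-p : ∀ j → Y (Fin.suc p) j ≈ M (Fin.suc p) j
      Y-at-p j = rowDifferencesFrom-above (suc (toℕ p)) M (Fin.suc p) j ℕₚ.≤-refl
      Y-before-p : ∀ j → Y (inject₁ p) j ≈ M (inject₁ p) j
      Y-before-p j = rowDifferencesFrom-above (suc (toℕ p)) M (inject₁ p) j
        (ℕₚ.m≤n⇒m≤1+n (ℕₚ.≤-reflexive (Finₚ.toℕ-inject₁ p)))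
      X-at-p : ∀ j → X (Fin.suc p) j ≈ Y (Fin.suc p) j - Y (inject₁ p) j
      X-at-p j with toℕ p ℕ.≤? toℕ p
      ... | yes _   = sym (+-cong (Y-at-p j) (-‿cong (Y-before-p j)))
      ... | no  p≰p = ⊥-elim (p≰p ℕₚ.≤-refl)
      X-elsewhere : ∀ i → i ≢ Fin.suc p → ∀ j → X i j ≈ Y i j
      X-elsewhere Fin.zero    _   j = refl
      X-elsewhere (Fin.suc i) i≢p j with toℕ p ℕ.≤? toℕ i | suc (toℕ p) ℕ.≤? toℕ i
      ... | yes _   | yes _   = refl
      ... | no  _   | no  _   = refl
      ... | no  p≰i | yes p<i = ⊥-elim (p≰i (ℕₚ.<⇒≤ p<i))
      ... | yes p≤i | no  p≮i = ⊥-elim (i≢p (cong Fin.suc (Finₚ.toℕ-injective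
                                  (≡.sym (ℕₚ.≤∧≮⇒≡ p≤i p≮i)))))

  det-rowDifferencesFrom : ∀ d {n} (M : Mat (suc n)) r → d ℕ.+ r ≡ n →
    det (suc n) (rowDifferencesFrom r M) ≈ det (suc n) M
  det-rowDifferencesFrom zero    M r ≡.refl =
    det-cong _ (λ i j → rowDifferencesFrom-above r M i j (Finₚ.toℕ≤pred[n] i))
  det-rowDifferencesFrom (suc d) M r ≡.refl = begin
    det _ (rowDifferencesFrom r M)
      ≡⟨ cong (λ r → det _ (rowDifferencesFrom r M)) (Finₚ.toℕ-fromℕ< r<n) ⟨
    det _ (rowDifferencesFrom (toℕ p) M)
      ≈⟨ det-rowDifferencesFrom-step (d ℕ.+ r) M p ⟩
    det _ (rowDifferencesFrom (suc (toℕ p)) M)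
      ≡⟨ cong (λ r → det _ (rowDifferencesFrom (suc r) M)) (Finₚ.toℕ-fromℕ< r<n) ⟩
    det _ (rowDifferencesFrom (suc r) M)
      ≈⟨ det-rowDifferencesFrom d M (suc r) (ℕₚ.+-suc d r) ⟩
    det _ M ∎
    where
      r<n : r ℕ.< suc (d ℕ.+ r)
      r<n = ℕ.s≤s (ℕₚ.m≤n+m r d)
      p : Fin (suc (d ℕ.+ r))
      p = Fin.fromℕ< r<n

  det-rowDifferences : ∀ n (M : Mat (suc n)) → det (suc n) (rowDifferences M) ≈ det (suc n) M
  det-rowDifferences n M = begin
    det (suc n) (rowDifferences M)        ≈⟨ det-cong (suc n) (rowDifferencesFrom-zero M) ⟨
    det (suc n) (rowDifferencesFrom 0 M)  ≈⟨ det-rowDifferencesFrom n M 0 (ℕₚ.+-identityʳ n) ⟩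
    det (suc n) M                         ∎

  det-last-column : ∀ n (M : Mat (suc n)) → (∀ i → i ≢ fromℕ n → M i (fromℕ n) ≈ 0#) →
    det (suc n) M ≈ det n (topLeft M) * M (fromℕ n) (fromℕ n)
  det-last-column zero M _ = begin
    1# * (M Fin.zero Fin.zero * 1#) + 0#  ≈⟨ +-identityʳ _ ⟩
    1# * (M Fin.zero Fin.zero * 1#)       ≈⟨ *-congˡ (*-identityʳ _) ⟩
    1# * M Fin.zero Fin.zero              ∎
  det-last-column (suc n) M last≈0 = begin
    det (suc (suc n)) M
      ≈⟨ det-expand-row₀ (suc n) M ⟩
    sum (row₀-term M)
      ≈⟨ sum-init-last (row₀-term M) ⟩
    sum (row₀-term M ∘ inject₁) + row₀-term M (fromℕ (suc n))
      ≈⟨ +-cong (sum-cong (row₀-term M ∘ inject₁) (λ j → row₀-term (topLeft M) j * corner) term≈)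
                (trans (*-congˡ (trans (*-congʳ (last≈0 Fin.zero (λ ()))) (zeroˡ _))) (zeroʳ _)) ⟩
    sum (λ j → row₀-term (topLeft M) j * corner) + 0#
      ≈⟨ +-identityʳ _ ⟩
    sum (λ j → row₀-term (topLeft M) j * corner)
      ≈⟨ *-distribʳ-sum corner (row₀-term (topLeft M)) ⟨
    sum (row₀-term (topLeft M)) * corner
      ≈⟨ *-congʳ (det-expand-row₀ n (topLeft M)) ⟨
    det (suc n) (topLeft M) * corner ∎
    where
      corner = M (fromℕ (suc n)) (fromℕ (suc n))
      term≈ : ∀ j → row₀-term M (inject₁ j) ≈ row₀-term (topLeft M) j * corner
      term≈ j = begin
        sgn (toℕ (inject₁ j)) * (M Fin.zero (inject₁ j) * det (suc n) M₀ⱼ)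
          ≈⟨ *-cong (reflexive (cong sgn (Finₚ.toℕ-inject₁ j))) (*-congˡ (det-last-column n M₀ⱼ minor-last≈0)) ⟩
        sgn (toℕ j) * (M Fin.zero (inject₁ j) * (det n (topLeft M₀ⱼ) * M₀ⱼ (fromℕ n) (fromℕ n)))
          ≈⟨ *-congˡ (*-congˡ (*-cong
               (det-cong n (λ r s → reflexive (cong (M (Fin.suc (inject₁ r))) (punchIn-inject₁ j s))))
               (reflexive (cong (M (fromℕ (suc n))) (punchIn-inject₁-fromℕ j))))) ⟩
        sgn (toℕ j) * (M Fin.zero (inject₁ j) * (det n (minor Fin.zero j (topLeft M)) * corner))
          ≈⟨ solve 4 (λ s x d c → (s ⊕ (x ⊕ (d ⊕ c))) ⊜ ((s ⊕ (x ⊕ d)) ⊕ c)) refl _ _ _ _ ⟩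
        row₀-term (topLeft M) j * corner ∎
        where
          M₀ⱼ = minor Fin.zero (inject₁ j) M
          minor-last≈0 : ∀ r → r ≢ fromℕ n → M₀ⱼ r (fromℕ n) ≈ 0#
          minor-last≈0 r r≢n = trans (reflexive (cong (M (Fin.suc r)) (punchIn-inject₁-fromℕ j)))
                                     (last≈0 (Fin.suc r) (r≢n ∘ Finₚ.suc-injective))

module RhsRecurrence {c ℓ : Level} (R : CommutativeRing c ℓ) where
  open CommutativeRing R hiding (zero)
  open Over R using (fromℕ; pow; sgn; ∑≤; rhs)
  open RingProperties ring using (-‿distribˡ-*; -‿distribʳ-*; -‿involutive)
  open CommSemigroupProperties +-commutativeSemigroup using (interchange)
  open import Relation.Binary.Reasoning.Setoid setoid
  open CommMonoidSolver *-commutativeMonoid using (solve; _⊜_; _⊕_)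

  sgn²≈1 : ∀ n → sgn n * sgn n ≈ 1#
  sgn²≈1 zero    = *-identityˡ 1#
  sgn²≈1 (suc n) = begin
    (- sgn n) * (- sgn n)  ≈⟨ -‿distribˡ-* _ _ ⟨
    - (sgn n * - sgn n)    ≈⟨ -‿cong (-‿distribʳ-* _ _) ⟨
    - - (sgn n * sgn n)    ≈⟨ -‿involutive _ ⟩
    sgn n * sgn n          ≈⟨ sgn²≈1 n ⟩
    1#                     ∎

  pow-neg : ∀ x i → pow (- x) i ≈ sgn i * pow x i
  pow-neg x zero    = sym (*-identityˡ 1#)
  pow-neg x (suc i) = begin
    (- x) * pow (- x) i        ≈⟨ *-congˡ (pow-neg x i) ⟩
    (- x) * (sgn i * pow x i)  ≈⟨ -‿distribˡ-* x _ ⟨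
    - (x * (sgn i * pow x i))  ≈⟨ -‿cong (solve 3 (λ x s p → (x ⊕ (s ⊕ p)) ⊜ (s ⊕ (x ⊕ p))) refl x (sgn i) (pow x i)) ⟩
    - (sgn i * (x * pow x i))  ≈⟨ -‿distribˡ-* (sgn i) _ ⟩
    (- sgn i) * (x * pow x i)  ∎

  fromℕ-+ : ∀ m n → fromℕ (m ℕ.+ n) ≈ fromℕ m + fromℕ n
  fromℕ-+ zero    n = sym (+-identityˡ _)
  fromℕ-+ (suc m) n = trans (+-congˡ (fromℕ-+ m n)) (sym (+-assoc 1# _ _))

  ∑≤-cong : ∀ n {f g : ℕ → Carrier} → (∀ i → i ℕ.≤ n → f i ≈ g i) → ∑≤ n f ≈ ∑≤ n g
  ∑≤-cong zero    f≈g = f≈g 0 ℕ.z≤n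
  ∑≤-cong (suc n) f≈g =
    +-cong (∑≤-cong n (λ i i≤n → f≈g i (ℕₚ.m≤n⇒m≤1+n i≤n))) (f≈g (suc n) ℕₚ.≤-refl)

  ∑≤-distrib-+ : ∀ n (f g : ℕ → Carrier) → ∑≤ n (λ i → f i + g i) ≈ ∑≤ n f + ∑≤ n g
  ∑≤-distrib-+ zero    f g = refl
  ∑≤-distrib-+ (suc n) f g = trans (+-congʳ (∑≤-distrib-+ n f g)) (interchange _ _ _ _)

  ∑≤-*ˡ : ∀ n a (f : ℕ → Carrier) → ∑≤ n (λ i → a * f i) ≈ a * ∑≤ n f
  ∑≤-*ˡ zero    a f = refl
  ∑≤-*ˡ (suc n) a f = trans (+-congʳ (∑≤-*ˡ n a f)) (sym (distribˡ a _ _))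

  ∑≤-shift : ∀ n (f : ℕ → Carrier) → ∑≤ (suc n) f ≈ f 0 + ∑≤ n (λ i → f (suc i))
  ∑≤-shift zero    f = refl
  ∑≤-shift (suc n) f = trans (+-congʳ (∑≤-shift n f)) (+-assoc _ _ _)

  σ : ℕ → Carrier
  σ i = sgn ⌊ suc i /2⌋

  sgn⌊i/2⌋≈sgn[i]σ[i] : ∀ i → sgn ⌊ i /2⌋ ≈ sgn i * σ i
  sgn⌊i/2⌋≈sgn[i]σ[i] zero          = sym (*-identityˡ 1#)
  sgn⌊i/2⌋≈sgn[i]σ[i] (suc zero)    = sym (sgn²≈1 1)
  sgn⌊i/2⌋≈sgn[i]σ[i] (suc (suc i)) = begin
    - sgn ⌊ i /2⌋          ≈⟨ -‿cong (sgn⌊i/2⌋≈sgn[i]σ[i] i) ⟩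
    - (sgn i * σ i)        ≈⟨ -‿distribʳ-* (sgn i) (σ i) ⟩
    sgn i * (- σ i)        ≈⟨ *-congʳ (-‿involutive (sgn i)) ⟨
    (- - sgn i) * (- σ i)  ∎

  σ-step : ∀ i a x → σ (suc i) * (a * pow x (suc i)) ≈ (- x) * (σ i * (a * pow (- x) i))
  σ-step i a x = sym (begin
    (- x) * (σ i * (a * pow (- x) i))        ≈⟨ *-congˡ (*-congˡ (*-congˡ (pow-neg x i))) ⟩
    (- x) * (σ i * (a * (sgn i * pow x i)))  ≈⟨ -‿distribˡ-* x _ ⟨
    - (x * (σ i * (a * (sgn i * pow x i))))  ≈⟨ -‿cong (solve 5 (λ x s a t p →
                                                  (x ⊕ (s ⊕ (a ⊕ (t ⊕ p)))) ⊜ ((t ⊕ s) ⊕ (a ⊕ (x ⊕ p))))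
                                                  refl x (σ i) a (sgn i) (pow x i)) ⟩
    - ((sgn i * σ i) * (a * (x * pow x i)))  ≈⟨ -‿cong (*-congʳ (sgn⌊i/2⌋≈sgn[i]σ[i] i)) ⟨
    - (sgn ⌊ i /2⌋ * (a * (x * pow x i)))    ≈⟨ -‿distribˡ-* _ _ ⟩
    (- sgn ⌊ i /2⌋) * (a * (x * pow x i))    ∎)

  rhs-term : ℕ → Carrier → ℕ → Carrier
  rhs-term k x i = σ i * (fromℕ ((⌊ k ∸ i /2⌋ ℕ.+ i) C i) * pow x i)

  rhs-term-pascal : ∀ h j x →
    σ (suc j) * (fromℕ ((suc h ℕ.+ suc j) C suc j) * pow x (suc j)) ≈
    σ (suc j) * (fromℕ ((h ℕ.+ suc j) C suc j) * pow x (suc j)) +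
    (- x) * (σ j * (fromℕ ((suc h ℕ.+ j) C j) * pow (- x) j))
  rhs-term-pascal h j x = begin
    s * (fromℕ (suc (h ℕ.+ suc j) C suc j) * p)
      ≡⟨ cong (λ m → s * (fromℕ m * p)) (nCk+nC[k+1]≡[n+1]C[k+1] (h ℕ.+ suc j) j) ⟨
    s * (fromℕ (a ℕ.+ b) * p)
      ≈⟨ *-congˡ (*-congʳ (trans (fromℕ-+ a b) (+-comm _ _))) ⟩
    s * ((fromℕ b + fromℕ a) * p)
      ≈⟨ trans (*-congˡ (distribʳ p _ _)) (distribˡ s _ _) ⟩
    s * (fromℕ b * p) + s * (fromℕ a * p)
      ≈⟨ +-congˡ (σ-step j (fromℕ a) x) ⟩
    s * (fromℕ b * p) + (- x) * (σ j * (fromℕ a * pow (- x) j))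
      ≡⟨ cong (λ m → s * (fromℕ b * p) + (- x) * (σ j * (fromℕ (m C j) * pow (- x) j))) (ℕₚ.+-suc h j) ⟩
    s * (fromℕ b * p) + (- x) * (σ j * (fromℕ ((suc h ℕ.+ j) C j) * pow (- x) j)) ∎
    where
      s = σ (suc j)
      p = pow x (suc j)
      a = (h ℕ.+ suc j) C j
      b = (h ℕ.+ suc j) C suc j

  rhs-term-diagonal : ∀ k i x → ⌊ k ∸ i /2⌋ ≡ 0 → rhs-term k x i ≡ σ i * (fromℕ 1 * pow x i)
  rhs-term-diagonal k i x ⌊k-i/2⌋≡0 =
    ≡.trans (cong (λ h → σ i * (fromℕ ((h ℕ.+ i) C i) * pow x i)) ⌊k-i/2⌋≡0)
            (cong (λ m → σ i * (fromℕ m * pow x i)) (nCn≡1 i))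

  rhs-term-edge : ∀ k k′ i x → ⌊ k ∸ i /2⌋ ≡ 0 → ⌊ k′ ∸ i /2⌋ ≡ 0 →
    rhs-term (suc k) x (suc i) ≈ (- x) * rhs-term k′ (- x) i
  rhs-term-edge k k′ i x h≡0 h′≡0 = begin
    rhs-term (suc k) x (suc i)               ≡⟨ rhs-term-diagonal (suc k) (suc i) x h≡0 ⟩
    σ (suc i) * (fromℕ 1 * pow x (suc i))    ≈⟨ σ-step i (fromℕ 1) x ⟩
    (- x) * (σ i * (fromℕ 1 * pow (- x) i))  ≡⟨ cong ((- x) *_) (rhs-term-diagonal k′ i (- x) h′≡0) ⟨
    (- x) * rhs-term k′ (- x) i              ∎

  rhs-recurrence : ∀ n x → rhs (suc (suc n)) x ≈ rhs n x - x * rhs (suc n) (- x)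
  rhs-recurrence n x = begin
    (∑≤ n t₂ + t₂ (suc n)) + t₂ (suc (suc n))
      ≈⟨ +-cong (+-cong (∑≤-cong n interior) (rhs-term-edge (suc n) (suc n) n x ⌊1/2⌋≡0 ⌊1/2⌋≡0))
                (rhs-term-edge (suc n) (suc n) (suc n) x ⌊0/2⌋≡0 ⌊0/2⌋≡0) ⟩
    (∑≤ n (λ i → t₀ i + v i) + v (suc n)) + v (suc (suc n))
      ≈⟨ +-congʳ (+-congʳ (∑≤-distrib-+ n t₀ v)) ⟩
    ((∑≤ n t₀ + ∑≤ n v) + v (suc n)) + v (suc (suc n))
      ≈⟨ trans (+-congʳ (+-assoc _ _ _)) (+-assoc _ _ _) ⟩
    ∑≤ n t₀ + ((∑≤ n v + v (suc n)) + v (suc (suc n)))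
      ≈⟨ +-congˡ (trans (∑≤-shift (suc n) v) (trans (+-identityˡ _) (∑≤-*ˡ (suc n) (- x) u))) ⟩
    rhs n x + (- x) * rhs (suc n) (- x)
      ≈⟨ +-congˡ (-‿distribˡ-* x _) ⟨
    rhs n x - x * rhs (suc n) (- x) ∎
    where
      t₂ = rhs-term (suc (suc n)) x
      t₀ = rhs-term n x
      u = rhs-term (suc n) (- x)
      v : ℕ → Carrier
      v zero    = 0#
      v (suc i) = (- x) * u i
      interior : ∀ i → i ℕ.≤ n → t₂ i ≈ t₀ i + v i
      interior zero    _   = sym (+-identityʳ _)
      interior (suc j) j<n rewrite suc-∸ j<n = rhs-term-pascal ⌊ n ∸ suc j /2⌋ j x
      ⌊1/2⌋≡0 : ⌊ suc n ∸ n /2⌋ ≡ 0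
      ⌊1/2⌋≡0 = cong ⌊_/2⌋ (ℕₚ.m+n∸n≡m 1 n)
      ⌊0/2⌋≡0 : ⌊ suc n ∸ suc n /2⌋ ≡ 0
      ⌊0/2⌋≡0 = cong ⌊_/2⌋ (ℕₚ.n∸n≡0 (suc n))

module DeterminantOfA {c ℓ : Level} (R : CommutativeRing c ℓ) where
  open CommutativeRing R hiding (zero)
  open Over R using (sgn; det; A; rhs)
  open Data.Fin using (fromℕ)
  open Determinant R
  open RhsRecurrence R using (sgn²≈1; rhs-recurrence)
  open import Algebra.Properties.Semiring.Sum semiring using (sum; sum-init-last)
  open RingProperties ring using (-‿distribˡ-*; x[y-z]≈xy-xz)
  open AbelianGroupProperties +-abelianGroup using (⁻¹-anti-homo‿-)
  open GroupProperties +-group using () renaming (ε⁻¹≈ε to -0≈0)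
  open CommSemigroupProperties +-commutativeSemigroup using (interchange)
  open import Relation.Binary.Reasoning.Setoid setoid
  open CommMonoidSolver *-commutativeMonoid using (solve; _⊜_; _⊕_)

  -- Indicators of boolean tests rather than of decisions: `suc x ≡ᵇ suc y` reduces to
  -- `x ≡ᵇ y`, whereas `suc x ℕ.≟ suc y` does not reduce to `x ℕ.≟ y`.
  𝟙 : Bool → Carrier
  𝟙 b = if b then 1# else 0#

  𝟙-true : ∀ {b} → T b → 𝟙 b ≈ 1#
  𝟙-true {true} _ = refl

  𝟙-false : ∀ {b} → ¬ T b → 𝟙 b ≈ 0#
  𝟙-false {true}  ¬b = ⊥-elim (¬b _)
  𝟙-false {false} _  = refl

  𝟙-⇔ : ∀ {a b} → (T a → T b) → (T b → T a) → 𝟙 a ≈ 𝟙 b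
  𝟙-⇔ {true}  a⇒b _   = sym (𝟙-true (a⇒b _))
  𝟙-⇔ {false} _   b⇒a = sym (𝟙-false b⇒a)

  𝟙-≡ : ∀ {x y} → x ≡ y → 𝟙 (x ℕ.≡ᵇ y) ≈ 1#
  𝟙-≡ {x} x≡y = 𝟙-true (ℕₚ.≡⇒≡ᵇ x _ x≡y)

  𝟙-≢ : ∀ {x y} → x ≢ y → 𝟙 (x ℕ.≡ᵇ y) ≈ 0#
  𝟙-≢ {x} {y} x≢y = 𝟙-false (x≢y ∘ ℕₚ.≡ᵇ⇒≡ x y)

  𝟙-≡ᵇ-sym : ∀ x y → 𝟙 (x ℕ.≡ᵇ y) ≈ 𝟙 (y ℕ.≡ᵇ x)
  𝟙-≡ᵇ-sym x y = 𝟙-⇔ (λ x≡y → ℕₚ.≡⇒≡ᵇ y x (≡.sym (ℕₚ.≡ᵇ⇒≡ x y x≡y)))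
                      (λ y≡x → ℕₚ.≡⇒≡ᵇ x y (≡.sym (ℕₚ.≡ᵇ⇒≡ y x y≡x)))

  𝟙-Fin-≟ : ∀ {n} (i j : Fin n) → 𝟙 ⌊ i Fin.≟ j ⌋ ≈ 𝟙 (toℕ i ℕ.≡ᵇ toℕ j)
  𝟙-Fin-≟ i j = 𝟙-⇔ (λ i≡j → ℕₚ.≡⇒≡ᵇ (toℕ i) (toℕ j) (cong toℕ (toWitness i≡j)))
                     (λ i≡j → fromWitness (Finₚ.toℕ-injective (ℕₚ.≡ᵇ⇒≡ (toℕ i) (toℕ j) i≡j)))

  𝟙-<? : ∀ k m → 𝟙 ⌊ k ℕ.<? m ⌋ ≈ 𝟙 (k ℕ.<ᵇ m)
  𝟙-<? k m = 𝟙-⇔ (λ k<m → ℕₚ.<⇒<ᵇ (toWitness k<m)) (λ k<m → fromWitness (ℕₚ.<ᵇ⇒< k m k<m))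

  𝟙-<ᵇ-suc : ∀ k m → 𝟙 (k ℕ.<ᵇ suc m) - 𝟙 (k ℕ.<ᵇ m) ≈ 𝟙 (m ℕ.≡ᵇ k)
  𝟙-<ᵇ-suc zero    zero    = trans (+-congˡ -0≈0) (+-identityʳ 1#)
  𝟙-<ᵇ-suc zero    (suc m) = -‿inverseʳ 1#
  𝟙-<ᵇ-suc (suc k) zero    = trans (+-congˡ -0≈0) (+-identityʳ 0#)
  𝟙-<ᵇ-suc (suc k) (suc m) = 𝟙-<ᵇ-suc k m

  𝟙-<ᵇ-suc-bounded : ∀ k y → y ℕ.≤ k → 𝟙 (k ℕ.<ᵇ suc y) ≡ 𝟙 (y ℕ.≡ᵇ k)
  𝟙-<ᵇ-suc-bounded zero    zero    _           = ≡.refl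
  𝟙-<ᵇ-suc-bounded (suc k) zero    _           = ≡.refl
  𝟙-<ᵇ-suc-bounded (suc k) (suc y) (ℕ.s≤s y≤k) = 𝟙-<ᵇ-suc-bounded k y y≤k

  x-0-b0≈x : ∀ x b → x - 0# - b * 0# ≈ x
  x-0-b0≈x x b = begin
    x - 0# - b * 0#  ≈⟨ +-cong (+-congˡ -0≈0) (trans (-‿cong (zeroʳ b)) -0≈0) ⟩
    x + 0# + 0#      ≈⟨ trans (+-identityʳ _) (+-identityʳ x) ⟩
    x                ∎

  -- B b n is A n b with every row but the first replaced by its difference with the
  -- previous one (0-based indices; the antidiagonal is x + y + 1 = n).
  B : Carrier → ℕ → ℕ → ℕ → Carrier
  B b n x y = 𝟙 (x ℕ.≡ᵇ y) - 𝟙 (x ℕ.≡ᵇ suc y) - b * 𝟙 (suc (x ℕ.+ y) ℕ.≡ᵇ n)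

  matrix : ∀ n → (ℕ → ℕ → Carrier) → Mat n
  matrix n F i j = F (toℕ i) (toℕ j)

  D : ℕ → Carrier → Carrier
  D n b = det n (matrix n (B b n))

  A-entry : ∀ k b (i j : Fin k) →
    A k b i j ≈ 𝟙 (toℕ i ℕ.≡ᵇ toℕ j) - b * 𝟙 (k ℕ.<ᵇ suc (suc (toℕ i ℕ.+ toℕ j)))
  A-entry k b i j = +-cong (𝟙-Fin-≟ i j) (-‿cong (*-congˡ (trans (𝟙-<? k _)
    (reflexive (cong (λ z → 𝟙 (k ℕ.<ᵇ z)) (ℕₚ.+-comm (toℕ i ℕ.+ toℕ j) 2))))))

  [p-bu]-[q-bv]≈[p-q]-b[u-v] : ∀ p q b u v → (p - b * u) - (q - b * v) ≈ (p - q) - b * (u - v)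
  [p-bu]-[q-bv]≈[p-q]-b[u-v] p q b u v = begin
    (p - b * u) - (q - b * v)      ≈⟨ +-congˡ (⁻¹-anti-homo‿- q (b * v)) ⟩
    (p - b * u) + (b * v - q)      ≈⟨ +-congˡ (+-comm _ _) ⟩
    (p - b * u) + (- q + b * v)    ≈⟨ interchange _ _ _ _ ⟩
    (p - q) + (- (b * u) + b * v)  ≈⟨ +-congˡ (+-comm _ _) ⟩
    (p - q) + (b * v - b * u)      ≈⟨ +-congˡ (⁻¹-anti-homo‿- (b * u) (b * v)) ⟨
    (p - q) - (b * u - b * v)      ≈⟨ +-congˡ (-‿cong (x[y-z]≈xy-xz b u v)) ⟨
    (p - q) - b * (u - v)          ∎

  rowDifferences-A : ∀ k b (i j : Fin (suc k)) →
    rowDifferences (A (suc k) b) i j ≈ matrix (suc k) (B b (suc k)) i j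
  rowDifferences-A k b Fin.zero j = begin
    A (suc k) b Fin.zero j
      ≈⟨ A-entry (suc k) b Fin.zero j ⟩
    𝟙 (0 ℕ.≡ᵇ toℕ j) - b * 𝟙 (k ℕ.<ᵇ suc (toℕ j))
      ≡⟨ cong (λ z → 𝟙 (0 ℕ.≡ᵇ toℕ j) - b * z) (𝟙-<ᵇ-suc-bounded k (toℕ j) (Finₚ.toℕ≤pred[n] j)) ⟩
    𝟙 (0 ℕ.≡ᵇ toℕ j) - b * 𝟙 (toℕ j ℕ.≡ᵇ k)
      ≈⟨ +-congʳ (trans (+-congˡ -0≈0) (+-identityʳ _)) ⟨
    B b (suc k) 0 (toℕ j) ∎
  rowDifferences-A k b (Fin.suc i) j = begin
    A (suc k) b (Fin.suc i) j - A (suc k) b (inject₁ i) j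
      ≈⟨ +-cong (A-entry (suc k) b (Fin.suc i) j) (-‿cong (A-entry (suc k) b (inject₁ i) j)) ⟩
    (𝟙 (suc x ℕ.≡ᵇ y) - b * 𝟙 (k ℕ.<ᵇ suc (suc (x ℕ.+ y)))) -
      (𝟙 (x′ ℕ.≡ᵇ y) - b * 𝟙 (k ℕ.<ᵇ suc (x′ ℕ.+ y)))
      ≡⟨ cong (λ z → (𝟙 (suc x ℕ.≡ᵇ y) - b * 𝟙 (k ℕ.<ᵇ suc (suc (x ℕ.+ y)))) -
                     (𝟙 (z ℕ.≡ᵇ y) - b * 𝟙 (k ℕ.<ᵇ suc (z ℕ.+ y))))
              (Finₚ.toℕ-inject₁ i) ⟩
    (𝟙 (suc x ℕ.≡ᵇ y) - b * 𝟙 (k ℕ.<ᵇ suc (suc (x ℕ.+ y)))) -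
      (𝟙 (x ℕ.≡ᵇ y) - b * 𝟙 (k ℕ.<ᵇ suc (x ℕ.+ y)))
      ≈⟨ [p-bu]-[q-bv]≈[p-q]-b[u-v] _ _ b _ _ ⟩
    (𝟙 (suc x ℕ.≡ᵇ y) - 𝟙 (x ℕ.≡ᵇ y)) - b * (𝟙 (k ℕ.<ᵇ suc (suc (x ℕ.+ y))) - 𝟙 (k ℕ.<ᵇ suc (x ℕ.+ y)))
      ≈⟨ +-congˡ (-‿cong (*-congˡ (𝟙-<ᵇ-suc k (suc (x ℕ.+ y))))) ⟩
    B b (suc k) (suc x) y ∎
    where
      x = toℕ i
      x′ = toℕ (inject₁ i)
      y = toℕ j

  det-A≈D : ∀ k b → det k (A k b) ≈ D k b
  det-A≈D zero    b = refl
  det-A≈D (suc k) b =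
    trans (sym (det-rowDifferences k (A (suc k) b))) (det-cong (suc k) (rowDifferences-A k b))

  B-shift : ∀ b n x y → B b (suc (suc n)) (suc x) (suc y) ≡ B b n x y
  B-shift b n x y = cong (λ z → 𝟙 (x ℕ.≡ᵇ y) - 𝟙 (x ℕ.≡ᵇ suc y) - b * 𝟙 (z ℕ.≡ᵇ n)) (ℕₚ.+-suc x y)

  B-last-column : ∀ b m x → x ℕ.≤ m → B b m x m ≈ 𝟙 (x ℕ.≡ᵇ m)
  B-last-column b m x x≤m = trans
    (+-cong (+-congˡ (-‿cong (𝟙-≢ (ℕₚ.<⇒≢ (ℕ.s≤s x≤m)))))
            (-‿cong (*-congˡ (𝟙-≢ (ℕₚ.>⇒≢ (ℕ.s≤s (ℕₚ.m≤n+m m x)))))))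
    (x-0-b0≈x _ b)

  det-B-bordered : ∀ m b → det (suc m) (matrix (suc m) (B b m)) ≈ D m b
  det-B-bordered m b = begin
    det (suc m) N                              ≈⟨ det-last-column m N last≈0 ⟩
    det m (topLeft N) * N (fromℕ m) (fromℕ m)  ≈⟨ *-cong (det-cong m topLeft≈) corner≈1 ⟩
    D m b * 1#                                 ≈⟨ *-identityʳ _ ⟩
    D m b                                      ∎
    where
      N = matrix (suc m) (B b m)
      toℕ-last : toℕ (fromℕ m) ≡ m
      toℕ-last = Finₚ.toℕ-fromℕ m
      last≈0 : ∀ i → i ≢ fromℕ m → N i (fromℕ m) ≈ 0#
      last≈0 i i≢m rewrite toℕ-last = trans (B-last-column b m (toℕ i) (Finₚ.toℕ≤pred[n] i))
        (𝟙-≢ (λ i≡m → i≢m (Finₚ.toℕ-injective (≡.trans i≡m (≡.sym toℕ-last)))))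
      corner≈1 : N (fromℕ m) (fromℕ m) ≈ 1#
      corner≈1 rewrite toℕ-last = trans (B-last-column b m m ℕₚ.≤-refl) (𝟙-≡ {m} ≡.refl)
      topLeft≈ : ∀ r s → topLeft N r s ≈ matrix m (B b m) r s
      topLeft≈ r s = reflexive (≡.cong₂ (B b m) (Finₚ.toℕ-inject₁ r) (Finₚ.toℕ-inject₁ s))

  p-q-bu≈-[q-p-[-b]u] : ∀ p q b u → p - q - b * u ≈ - (q - p - (- b) * u)
  p-q-bu≈-[q-p-[-b]u] p q b u = sym (begin
    - (q - p - (- b) * u)  ≈⟨ ⁻¹-anti-homo‿- (q - p) _ ⟩
    (- b) * u - (q - p)    ≈⟨ +-congˡ (⁻¹-anti-homo‿- q p) ⟩
    (- b) * u + (p - q)    ≈⟨ +-comm _ _ ⟩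
    p - q + (- b) * u      ≈⟨ +-congˡ (-‿distribˡ-* b u) ⟨
    p - q - b * u          ∎)

  B-shift-transpose : ∀ b m x y → B b (suc (suc m)) (suc x) y ≈ - B (- b) (suc m) y x
  B-shift-transpose b m x y = begin
    𝟙 (suc x ℕ.≡ᵇ y) - 𝟙 (x ℕ.≡ᵇ y) - b * 𝟙 (x ℕ.+ y ℕ.≡ᵇ m)
      ≈⟨ +-cong (+-cong (𝟙-≡ᵇ-sym (suc x) y) (-‿cong (𝟙-≡ᵇ-sym x y)))
                (-‿cong (*-congˡ (reflexive (cong (λ z → 𝟙 (z ℕ.≡ᵇ m)) (ℕₚ.+-comm x y))))) ⟩
    𝟙 (y ℕ.≡ᵇ suc x) - 𝟙 (y ℕ.≡ᵇ x) - b * 𝟙 (y ℕ.+ x ℕ.≡ᵇ m)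
      ≈⟨ p-q-bu≈-[q-p-[-b]u] _ _ b _ ⟩
    - B (- b) (suc m) y x ∎

  det-B-corner-minor : ∀ m b →
    det (suc m) (minor Fin.zero (fromℕ (suc m)) (matrix (suc (suc m)) (B b (suc (suc m))))) ≈
    sgn (suc m) * D (suc m) (- b)
  det-B-corner-minor m b = begin
    det (suc m) (minor Fin.zero (fromℕ (suc m)) (matrix (suc (suc m)) (B b (suc (suc m)))))
      ≈⟨ det-cong (suc m) entries ⟩
    det (suc m) (λ r s → - transpose N r s)
      ≈⟨ det-negate (suc m) (transpose N) ⟩
    sgn (suc m) * det (suc m) (transpose N)
      ≈⟨ *-congˡ (det-transpose (suc m) N) ⟩
    sgn (suc m) * D (suc m) (- b) ∎
    where
      N = matrix (suc m) (B (- b) (suc m))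
      entries : ∀ r s → B b (suc (suc m)) (suc (toℕ r)) (toℕ (punchIn (fromℕ (suc m)) s)) ≈
                        - B (- b) (suc m) (toℕ s) (toℕ r)
      entries r s rewrite punchIn-fromℕ (suc m) s | Finₚ.toℕ-inject₁ s = B-shift-transpose b m (toℕ r) (toℕ s)

  D-recurrence : ∀ m b → D (suc (suc m)) b ≈ D m b - b * D (suc m) (- b)
  D-recurrence m b = begin
    det (suc (suc m)) M
      ≈⟨ det-expand-row₀ (suc m) M ⟩
    row₀-term M Fin.zero + sum (row₀-term M ∘ Fin.suc)
      ≈⟨ +-congˡ (sum-init-last (row₀-term M ∘ Fin.suc)) ⟩
    row₀-term M Fin.zero + (sum (row₀-term M ∘ Fin.suc ∘ inject₁) + row₀-term M (fromℕ (suc m)))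
      ≈⟨ +-cong first≈ (+-cong (sum-zero _ middle≈0) last≈) ⟩
    D m b + (0# + - (b * D (suc m) (- b)))
      ≈⟨ +-congˡ (+-identityˡ _) ⟩
    D m b - b * D (suc m) (- b) ∎
    where
      M = matrix (suc (suc m)) (B b (suc (suc m)))
      first≈ : row₀-term M Fin.zero ≈ D m b
      first≈ = begin
        1# * ((1# - 0# - b * 0#) * det (suc m) (minor Fin.zero Fin.zero M))
          ≈⟨ trans (*-identityˡ _) (trans (*-congʳ (x-0-b0≈x 1# b)) (*-identityˡ _)) ⟩
        det (suc m) (minor Fin.zero Fin.zero M)
          ≈⟨ det-cong (suc m) (λ r s → reflexive (B-shift b m (toℕ r) (toℕ s))) ⟩
        det (suc m) (matrix (suc m) (B b m))
          ≈⟨ det-B-bordered m b ⟩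
        D m b ∎
      middle≈0 : ∀ i → row₀-term M (Fin.suc (inject₁ i)) ≈ 0#
      middle≈0 i = trans (*-congˡ (trans (*-congʳ entry≈0) (zeroˡ _))) (zeroʳ _)
        where
          entry≈0 : M Fin.zero (Fin.suc (inject₁ i)) ≈ 0#
          entry≈0 = trans (+-congˡ (-‿cong (*-congˡ (𝟙-≢ (ℕₚ.<⇒≢ (ℕₚ.≤-<-trans
                      (ℕₚ.≤-reflexive (Finₚ.toℕ-inject₁ i)) (Finₚ.toℕ<n i)))))))
                    (x-0-b0≈x 0# b)
      last≈ : row₀-term M (fromℕ (suc m)) ≈ - (b * D (suc m) (- b))
      last≈ = begin
        sgn (toℕ (fromℕ (suc m))) *
          (M Fin.zero (fromℕ (suc m)) * det (suc m) (minor Fin.zero (fromℕ (suc m)) M))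
          ≈⟨ *-cong (reflexive (cong sgn (Finₚ.toℕ-fromℕ (suc m)))) (*-cong entry≈-b (det-B-corner-minor m b)) ⟩
        s * ((- b) * (s * D (suc m) (- b)))
          ≈⟨ solve 3 (λ s x d → (s ⊕ (x ⊕ (s ⊕ d))) ⊜ ((s ⊕ s) ⊕ (x ⊕ d))) refl s (- b) _ ⟩
        (s * s) * ((- b) * D (suc m) (- b))
          ≈⟨ trans (*-congʳ (sgn²≈1 (suc m))) (*-identityˡ _) ⟩
        (- b) * D (suc m) (- b)
          ≈⟨ -‿distribˡ-* b _ ⟨
        - (b * D (suc m) (- b)) ∎
        where
          s = sgn (suc m)
          entry≈-b : M Fin.zero (fromℕ (suc m)) ≈ - b
          entry≈-b = begin
            𝟙 false - 0# - b * 𝟙 (toℕ (fromℕ m) ℕ.≡ᵇ m)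
              ≈⟨ +-cong (trans (+-congˡ -0≈0) (+-identityʳ _)) (-‿cong (*-congˡ (𝟙-≡ (Finₚ.toℕ-fromℕ m)))) ⟩
            0# - b * 1#
              ≈⟨ trans (+-identityˡ _) (-‿cong (*-identityʳ b)) ⟩
            - b ∎

  D-one : ∀ b → D 1 b ≈ 1# - b
  D-one b = begin
    1# * ((1# - 0# - b * 1#) * 1#) + 0#  ≈⟨ trans (+-identityʳ _) (trans (*-identityˡ _) (*-identityʳ _)) ⟩
    1# - 0# - b * 1#                     ≈⟨ +-cong (trans (+-congˡ -0≈0) (+-identityʳ 1#)) (-‿cong (*-identityʳ b)) ⟩
    1# - b                               ∎

  rhs-one : ∀ b → rhs 1 b ≈ 1# - b
  rhs-one b = begin
    1# * ((1# + 0#) * 1#) + (- 1#) * ((1# + 0#) * (b * 1#))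
      ≈⟨ +-cong (trans (*-identityˡ _) (trans (*-identityʳ _) (+-identityʳ 1#)))
                (trans (sym (-‿distribˡ-* _ _)) (-‿cong (trans (*-identityˡ _)
                  (trans (*-congʳ (+-identityʳ 1#)) (trans (*-identityˡ _) (*-identityʳ b)))))) ⟩
    1# - b ∎

  D≈rhs : ∀ n b → D n b ≈ rhs n b
  D≈rhs zero          b = sym (trans (*-identityˡ _) (trans (*-identityʳ _) (+-identityʳ 1#)))
  D≈rhs (suc zero)    b = trans (D-one b) (sym (rhs-one b))
  D≈rhs (suc (suc n)) b = begin
    D (suc (suc n)) b                ≈⟨ D-recurrence n b ⟩
    D n b - b * D (suc n) (- b)      ≈⟨ +-cong (D≈rhs n b) (-‿cong (*-congˡ (D≈rhs (suc n) (- b)))) ⟩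
    rhs n b - b * rhs (suc n) (- b)  ≈⟨ rhs-recurrence n b ⟨
    rhs (suc (suc n)) b              ∎

lemma4 : ∀ {c ℓ : Level} (R : CommutativeRing c ℓ) (k : ℕ) → k % 2 ≡ 1 →
    (b : CommutativeRing.Carrier R) →
    CommutativeRing._≈_ R (Over.det R k (Over.A R k b)) (Over.rhs R k b)
lemma4 R k _ b = CommutativeRing.trans R (det-A≈D k b) (D≈rhs k b)
  where open DeterminantOfA R
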